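{- Let $k\ge1$ and $m$ be integers and let $X$ be a finite $(k-1)$-pure simplicial complex with facet set $F$, $\phi=|F|$ facets, $x_0$ vertices and shape $x$. If $m>kx_0\phi$, then every $m$-pure $F$-shape $w\ne r$ satisfies $b(x,w)>b(x,r)$, where $r$ is the $m$-pure $F$-shape with $r^\cap_A=0$ for every $A\subseteq F$ with $|A|\ge2$.
   Context: Let $F$ be a finite set. An $F$-set is a map $W:F\to\mathcal P(S)$, $S$ finite, with $W_0=\bigcup_{f\in F}W(f)$. For $A\subseteq F$: $W^\cap_A=\bigcap_{f\in A}W(f)$ ($W^\cap_\emptyset=W_0$), $W^\cup_A=\bigcup_{f\in A}W(f)$, $W^!_A=\{v\in W_0:\{f: v\in W(f)\}=A\}$. The shape $w$ of $W$ is given by $w^*_A=|W^*_A|$ for $*\in\{\cap,!,\cup\}$ and $w_0=|W_0|$; an $F$-shape is the shape of some $F$-set. It is $m$-pure if $w^\cap_{\{f\}}=m$ for all $f\in F$. The shape of the complex $X$ is the shape of the $F$-set $f\mapsto f$ (facets as vertex sets). For $F$-shapes $x,w$: $(xw)_0=\sum_{\emptyset\ne B\subseteq F}(-1)^{|B|-1}x^\cap_Bw^\cap_B$ and $b(x,w)=\frac{(xw)_0}{x_0+w_0}$. A simplicial complex is $(k-1)$-pure if all its facets have exactly $k$ vertices. -}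

module Defs where

open import Data.Nat using (ℕ; zero; suc; _+_; _*_; _<_; _≤_)
open import Data.Bool using (Bool; true; false)
open import Data.Bool.Properties using () renaming (_≟_ to _≟B_)
open import Data.Fin using (Fin)
open import Data.Fin.Subset using (Subset; ⋂; ⋃; ∣_∣; _∈_; _⊆_; outside; inside)
open import Data.Fin.Subset.Properties using (_∈?_)
open import Data.Vec using (Vec; []; _∷_; tabulate)
open import Data.Vec.Properties using (≡-dec)
open import Data.List using (List; []; _∷_; map; _++_; filter; allFin; sum)
open import Data.Integer using (ℤ; +_; -_)
import Data.Integer as ℤ
open import Data.Rational using (ℚ; 0ℚ; _/_)
open import Data.Product using (Σ; ∃; _×_; _,_)
open import Relation.Nullary using (¬_; does)
open import Relation.Binary.PropositionalEquality using (_≡_)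

-- F is represented as Fin φ; subsets A ⊆ F as Subset φ.
-- An F-set is W : Fin φ → Subset n  (the finite ground set S is Fin n).

members : ∀ {φ n} → (Fin φ → Subset n) → Subset φ → List (Subset n)
members {φ} W A = map W (filter (_∈? A) (allFin φ))

W₀ : ∀ {φ n} → (Fin φ → Subset n) → Subset n
W₀ {φ} W = ⋃ (map W (allFin φ))

W∩ : ∀ {φ n} → (Fin φ → Subset n) → Subset φ → Subset n
W∩ W A with members W A
... | []     = W₀ W
... | s ∷ ss = ⋂ (s ∷ ss)

W∪ : ∀ {φ n} → (Fin φ → Subset n) → Subset φ → Subset n
W∪ W A = ⋃ (members W A)

profile : ∀ {φ n} → (Fin φ → Subset n) → Fin n → Subset φ
profile W v = tabulate λ f → does (v ∈? W f)

W! : ∀ {φ n} → (Fin φ → Subset n) → Subset φ → Subset n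
W! W A = tabulate λ v → does (v ∈? W₀ W) Data.Bool.∧ does (≡-dec _≟B_ (profile W v) A)
  where import Data.Bool

record ShapeData (φ : ℕ) : Set where
  field
    cap  : Subset φ → ℕ
    excl : Subset φ → ℕ
    cup  : Subset φ → ℕ
    zer  : ℕ
open ShapeData public

shape : ∀ {φ n} → (Fin φ → Subset n) → ShapeData φ
shape W = record
  { cap  = λ A → ∣ W∩ W A ∣
  ; excl = λ A → ∣ W! W A ∣
  ; cup  = λ A → ∣ W∪ W A ∣
  ; zer  = ∣ W₀ W ∣ }

_≈S_ : ∀ {φ} → ShapeData φ → ShapeData φ → Set
w ≈S v = (∀ A → cap w A ≡ cap v A) × (∀ A → excl w A ≡ excl v A)
       × (∀ A → cup w A ≡ cup v A) × (zer w ≡ zer v)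

IsFShape : ∀ {φ} → ShapeData φ → Set
IsFShape {φ} w = Σ ℕ λ n → Σ (Fin φ → Subset n) λ W → shape W ≈S w

singleton : ∀ {φ} → Fin φ → Subset φ
singleton f = tabulate λ g → does (g Data.Fin.≟ f)
  where import Data.Fin

IsPure : ∀ {φ} → ℕ → ShapeData φ → Set
IsPure {φ} m w = ∀ (f : Fin φ) → cap w (singleton f) ≡ m

allSubsets : ∀ φ → List (Subset φ)
allSubsets zero    = [] ∷ []
allSubsets (suc φ) = map (outside ∷_) (allSubsets φ) ++ map (inside ∷_) (allSubsets φ)

term : ∀ {φ} → ShapeData φ → ShapeData φ → Subset φ → ℤ
term x w B with ∣ B ∣
... | zero  = + 0
... | suc j = sgn j ℤ.* (+ (cap x B * cap w B))
  where
  sgn : ℕ → ℤ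
  sgn zero          = + 1
  sgn (suc zero)    = - (+ 1)
  sgn (suc (suc i)) = sgn i

prod₀ : ∀ {φ} → ShapeData φ → ShapeData φ → ℤ
prod₀ {φ} x w = ℤsum (map (term x w) (allSubsets φ))
  where
  ℤsum : List ℤ → ℤ
  ℤsum []       = + 0
  ℤsum (z ∷ zs) = z ℤ.+ ℤsum zs

-- b(x,w) = (xw)_0 / (x_0 + w_0)   (convention: 0 if the denominator is 0)
b : ∀ {φ} → ShapeData φ → ShapeData φ → ℚ
b x w with zer x + zer w
... | zero  = 0ℚ
... | suc d = prod₀ x w / suc d

-- A finite simplicial complex on vertex set Fin n, given by its facets
-- indexed by F = Fin φ: distinct facets, no facet contained in another,
-- and every vertex lies in some facet.
record IsFacetFamily {φ n : ℕ} (X : Fin φ → Subset n) : Set where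
  field
    distinct : ∀ f g → X f ≡ X g → f ≡ g
    antichain : ∀ f g → X f ⊆ X g → f ≡ g
    covers : ∀ (v : Fin n) → ∃ λ f → v ∈ X f

-- (k-1)-pure: every facet has exactly k vertices
IsPureComplex : ∀ {φ n} → ℕ → (Fin φ → Subset n) → Set
IsPureComplex {φ} k X = ∀ (f : Fin φ) → ∣ X f ∣ ≡ k

-- Every shape component of an F-set W counts the vertices v whose profile
-- {f : v ∈ W f} satisfies a fixed Boolean condition. Inclusion–exclusion over
-- B ⊆ F gives (xw)₀ = Σ_v x^∪_{profile v}. An F-set of shape r has profiles of
-- size at most one, hence r₀ = φm and (xr)₀ = φmk, and every m-pure F-set with
-- this property has shape r. Otherwise some profile has two elements, and
-- b(x,r) < b(x,w) amounts to φmk(x₀+w₀) < (xw)₀(x₀+φm). This is the sum over the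
-- vertices of W of k x₀ |q| + kφm ≤ x^∪_q (x₀+φm) for the profile q ≠ ∅ of each
-- vertex, which holds as a facet has k vertices and is strict when |q| ≥ 2: two
-- distinct facets of the antichain cover at least k+1 vertices, and k x₀ φ < m.

module Submission where

open import Defs
open import Data.Nat using (ℕ; zero; suc; _+_; _*_; _<_; _≤_; _≥_; z≤n; s≤s; >-nonZero)
import Data.Nat.Properties as ℕ
open import Data.Nat.Tactic.RingSolver using (solve-∀)
import Data.Fin.Properties as Fin
open import Data.Integer using (ℤ; +_; -_; 0ℤ; 1ℤ; -1ℤ; +<+) renaming (_+_ to _+ℤ_; _*_ to _*ℤ_; _<_ to _<ℤ_)
import Data.Integer.Properties as ℤ
open import Data.Bool using (Bool; true; false; _∧_; _∨_; not; if_then_else_)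
open import Data.Fin using (Fin; zero; suc)
open import Data.Fin.Subset using (Subset; ∣_∣; inside; outside; ⊥; ⊤; _∩_; _∪_; ⋃; ⋂; _∈_; _∉_; _⊆_)
open import Data.Fin.Subset.Properties
  using (∣p∣≤n; _∈?_; ∈⊤; ∩-comm; ∩-identityˡ; ∩-identityʳ; ∩-zeroˡ; ∩-zeroʳ;
         x∈p∩q⁺; x∈p∪q⁻; x∈p∪q⁺; q⊆p∪q; p⊆q⇒∣p∣≤∣q∣; p⊂q⇒∣p∣<∣q∣)
open import Data.Vec using ([]; _∷_; here; there; lookup; tabulate; replicate)
import Data.Vec.Properties as Vec
open import Data.List using (List; []; _∷_; map; _++_; foldr; filter; allFin)
import Data.List as List
import Data.List.Properties as List
import Data.Bool.Properties as Bool
open import Data.List.Relation.Unary.All using (universal)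
open import Data.Bool.ListAction using (any; all)
open import Data.Product using (_,_; _×_; ∃; ∃₂; proj₂)
open import Function using (_∘_; id)
open import Relation.Nullary using (¬_; does; yes; no; _→-dec_)
open import Data.Empty using (⊥-elim)
open import Data.Sum using (_⊎_; inj₁; inj₂)
open import Data.Rational using (_/_) renaming (_<_ to _<ℚ_)
import Data.Rational.Properties as ℚ
import Data.Rational.Unnormalised as ℚᵘ
import Data.Rational.Unnormalised.Properties as ℚᵘ
open import Relation.Binary.PropositionalEquality

import Algebra.Properties.Semiring.Sum as Sum
open Sum ℕ.+-*-semiring
  using (sum; sum-syntax; sum-cong-≗; ∑-distrib-+; ∑-comm; *-distribˡ-sum; *-distribʳ-sum; sum-replicate-zero)
module ℤ∑ = Sum ℤ.+-*-semiring

vertex-inequality-one : ∀ k x₀ M U → k ≤ U → k * x₀ * 1 + k * M * 1 ≤ U * (x₀ + M)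
vertex-inequality-one k x₀ M U k≤U = begin
  k * x₀ * 1 + k * M * 1 ≡⟨ cong₂ _+_ (ℕ.*-identityʳ (k * x₀)) (ℕ.*-identityʳ (k * M)) ⟩
  k * x₀ + k * M         ≡⟨ ℕ.*-distribˡ-+ k x₀ M ⟨
  k * (x₀ + M)           ≤⟨ ℕ.*-monoˡ-≤ (x₀ + M) k≤U ⟩
  U * (x₀ + M)           ∎
  where open ℕ.≤-Reasoning

vertex-inequality-many : ∀ k x₀ φ m M c U → k * x₀ * φ < m → m ≤ M → c ≤ φ → suc k ≤ U →
                         k * x₀ * c + k * M * 1 < U * (x₀ + M)
vertex-inequality-many k x₀ φ m M c U kx₀φ<m m≤M c≤φ k<U = begin-strict
  k * x₀ * c + k * M * 1 ≡⟨ cong (_+_ (k * x₀ * c)) (ℕ.*-identityʳ (k * M)) ⟩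
  k * x₀ * c + k * M     ≤⟨ ℕ.+-monoˡ-≤ (k * M) (ℕ.*-monoʳ-≤ (k * x₀) c≤φ) ⟩
  k * x₀ * φ + k * M     <⟨ ℕ.+-monoˡ-< (k * M) kx₀φ<m ⟩
  m + k * M              ≤⟨ ℕ.+-monoˡ-≤ (k * M) m≤M ⟩
  suc k * M              ≤⟨ ℕ.*-monoʳ-≤ (suc k) (ℕ.m≤n+m M x₀) ⟩
  suc k * (x₀ + M)       ≤⟨ ℕ.*-monoˡ-≤ (x₀ + M) k<U ⟩
  U * (x₀ + M)           ∎
  where open ℕ.≤-Reasoning

vertex-sum-identity : ∀ k x₀ φ m w₀ → k * x₀ * (φ * m) + k * (φ * m) * w₀ ≡ φ * m * k * (x₀ + w₀)
vertex-sum-identity = solve-∀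

open ≡-Reasoning

∑-const : ∀ n c → ∑[ i < n ] c ≡ n * c
∑-const zero    c = refl
∑-const (suc n) c = cong (_+_ c) (∑-const n c)

∑-mono-≤ : ∀ {n} {g h : Fin n → ℕ} → (∀ i → g i ≤ h i) → sum g ≤ sum h
∑-mono-≤ {zero}  g≤h = z≤n
∑-mono-≤ {suc n} g≤h = ℕ.+-mono-≤ (g≤h zero) (∑-mono-≤ (g≤h ∘ suc))

∑-mono-< : ∀ {n} {g h : Fin n → ℕ} → (∀ i → g i ≤ h i) → ∀ i → g i < h i → sum g < sum h
∑-mono-< g≤h zero    gi<hi = ℕ.+-mono-<-≤ gi<hi (∑-mono-≤ (g≤h ∘ suc))
∑-mono-< g≤h (suc i) gi<hi = ℕ.+-mono-≤-< (g≤h zero) (∑-mono-< (g≤h ∘ suc) i gi<hi)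

≤-∑ : ∀ {n} (h : Fin n → ℕ) i → h i ≤ sum h
≤-∑ h zero    = ℕ.m≤m+n _ _
≤-∑ h (suc i) = ℕ.≤-trans (≤-∑ (h ∘ suc) i) (ℕ.m≤n+m _ (h zero))

+-∑ : ∀ {n} (h : Fin n → ℕ) → + (sum h) ≡ ℤ∑.sum (λ i → + h i)
+-∑ {zero}  h = refl
+-∑ {suc n} h = trans (ℤ.pos-+ (h zero) (sum (h ∘ suc))) (cong (+ h zero +ℤ_) (+-∑ (h ∘ suc)))

*-+-∑ : ∀ {n} c (h : Fin n → ℕ) → c *ℤ + (sum h) ≡ ℤ∑.sum (λ i → c *ℤ + h i)
*-+-∑ c h = trans (cong (c *ℤ_) (+-∑ h)) (ℤ∑.*-distribˡ-sum c (λ i → + h i))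

+-∑∑ : ∀ {m n} (h : Fin m → Fin n → ℕ) →
       + (∑[ i < m ] ∑[ j < n ] h i j) ≡ ℤ∑.sum (λ i → ℤ∑.sum (λ j → + h i j))
+-∑∑ h = trans (+-∑ (λ i → sum (h i))) (ℤ∑.sum-cong-≗ (λ i → +-∑ (h i)))

*-+-∑∑ : ∀ {m n} c (h : Fin m → Fin n → ℕ) →
         c *ℤ + (∑[ i < m ] ∑[ j < n ] h i j) ≡ ℤ∑.sum (λ i → ℤ∑.sum (λ j → c *ℤ + h i j))
*-+-∑∑ c h = trans (*-+-∑ c (λ i → sum (h i))) (ℤ∑.sum-cong-≗ (λ i → *-+-∑ c (h i)))

⟦_⟧ : Bool → ℕ
⟦ true ⟧  = 1
⟦ false ⟧ = 0

nonemptyᵇ : ∀ {n} → Subset n → Bool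
nonemptyᵇ []      = false
nonemptyᵇ (x ∷ p) = x ∨ nonemptyᵇ p

infix 7 _⊆ᵇ_
_⊆ᵇ_ : ∀ {n} → Subset n → Subset n → Bool
[]            ⊆ᵇ []      = true
(outside ∷ p) ⊆ᵇ (_ ∷ q) = p ⊆ᵇ q
(inside  ∷ p) ⊆ᵇ (y ∷ q) = y ∧ p ⊆ᵇ q

capᵇ : ∀ {φ} → Subset φ → Subset φ → Bool
capᵇ A p = if nonemptyᵇ A then A ⊆ᵇ p else nonemptyᵇ p

exclᵇ : ∀ {φ} → Subset φ → Subset φ → Bool
exclᵇ A p = nonemptyᵇ p ∧ does (Vec.≡-dec Bool._≟_ p A)

nonemptyᵇ-⊥ : ∀ n → nonemptyᵇ (⊥ {n}) ≡ false
nonemptyᵇ-⊥ zero    = refl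
nonemptyᵇ-⊥ (suc n) = nonemptyᵇ-⊥ n

∈⇒nonemptyᵇ : ∀ {n} {f : Fin n} {p} → f ∈ p → nonemptyᵇ p ≡ true
∈⇒nonemptyᵇ here            = refl
∈⇒nonemptyᵇ {p = x ∷ _} (there f∈p) = trans (cong (x ∨_) (∈⇒nonemptyᵇ f∈p)) (Bool.∨-zeroʳ x)

⊆ᵇ-refl : ∀ {n} (p : Subset n) → p ⊆ᵇ p ≡ true
⊆ᵇ-refl []            = refl
⊆ᵇ-refl (outside ∷ p) = ⊆ᵇ-refl p
⊆ᵇ-refl (inside  ∷ p) = ⊆ᵇ-refl p

⊆ᵇ⊥ : ∀ {n} (A : Subset n) → A ⊆ᵇ ⊥ ≡ not (nonemptyᵇ A)
⊆ᵇ⊥ []            = refl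
⊆ᵇ⊥ (outside ∷ A) = ⊆ᵇ⊥ A
⊆ᵇ⊥ (inside  ∷ A) = refl

⊥⊆ᵇ : ∀ {n} (p : Subset n) → ⊥ ⊆ᵇ p ≡ true
⊥⊆ᵇ []      = refl
⊥⊆ᵇ (_ ∷ p) = ⊥⊆ᵇ p

⊆ᵇ-∩ : ∀ {n} (B p q : Subset n) → B ⊆ᵇ p ∧ B ⊆ᵇ q ≡ B ⊆ᵇ (p ∩ q)
⊆ᵇ-∩ []            []      []      = refl
⊆ᵇ-∩ (outside ∷ B) (_ ∷ p) (_ ∷ q) = ⊆ᵇ-∩ B p q
⊆ᵇ-∩ (inside  ∷ B) (true  ∷ p) (true  ∷ q) = ⊆ᵇ-∩ B p q
⊆ᵇ-∩ (inside  ∷ B) (true  ∷ p) (false ∷ q) = Bool.∧-zeroʳ (B ⊆ᵇ p)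
⊆ᵇ-∩ (inside  ∷ B) (false ∷ p) (_     ∷ q) = refl

¬nonemptyᵇ⇒∣p∣≡0 : ∀ {n} (p : Subset n) → nonemptyᵇ p ≡ false → ∣ p ∣ ≡ 0
¬nonemptyᵇ⇒∣p∣≡0 []            _ = refl
¬nonemptyᵇ⇒∣p∣≡0 (outside ∷ p) e = ¬nonemptyᵇ⇒∣p∣≡0 p e

⟦∧⟧ : ∀ a b → ⟦ a ⟧ * ⟦ b ⟧ ≡ ⟦ a ∧ b ⟧
⟦∧⟧ true  true  = refl
⟦∧⟧ true  false = refl
⟦∧⟧ false _     = refl

capᵇ-⊥ : ∀ {φ} (A : Subset φ) → capᵇ A ⊥ ≡ false
capᵇ-⊥ {φ} A rewrite ⊆ᵇ⊥ A | nonemptyᵇ-⊥ φ with nonemptyᵇ A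
... | true  = refl
... | false = refl

tabulate-const : ∀ {n} {A : Set} (a : A) → tabulate {n = n} (λ _ → a) ≡ replicate n a
tabulate-const {zero}  a = refl
tabulate-const {suc n} a = cong (a ∷_) (tabulate-const a)

singleton-zero : ∀ {φ} → singleton {suc φ} zero ≡ inside ∷ ⊥
singleton-zero = cong (inside ∷_) (tabulate-const false)

nonemptyᵇ-singleton : ∀ {φ} (f : Fin φ) → nonemptyᵇ (singleton f) ≡ true
nonemptyᵇ-singleton zero    = refl
nonemptyᵇ-singleton (suc f) = nonemptyᵇ-singleton f

singleton-⊆ᵇ : ∀ {φ} (f : Fin φ) (p : Subset φ) → singleton f ⊆ᵇ p ≡ lookup p f
singleton-⊆ᵇ zero    (y ∷ p) = begin
  singleton zero ⊆ᵇ (y ∷ p) ≡⟨ cong (_⊆ᵇ (y ∷ p)) singleton-zero ⟩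
  y ∧ ⊥ ⊆ᵇ p                ≡⟨ cong (y ∧_) (⊥⊆ᵇ p) ⟩
  y ∧ true                  ≡⟨ Bool.∧-identityʳ y ⟩
  y                         ∎
singleton-⊆ᵇ (suc f) (y ∷ p) = singleton-⊆ᵇ f p

capᵇ-singleton : ∀ {φ} (f : Fin φ) (p : Subset φ) → capᵇ (singleton f) p ≡ lookup p f
capᵇ-singleton f p rewrite nonemptyᵇ-singleton f = singleton-⊆ᵇ f p

nonemptyᵇ-singleton-∩ : ∀ {φ} (f : Fin φ) (p : Subset φ) → nonemptyᵇ (singleton f ∩ p) ≡ lookup p f
nonemptyᵇ-singleton-∩ {suc φ} zero (y ∷ p) = begin
  nonemptyᵇ (singleton zero ∩ (y ∷ p)) ≡⟨ cong (λ s → nonemptyᵇ (s ∩ (y ∷ p))) singleton-zero ⟩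
  y ∨ nonemptyᵇ (⊥ ∩ p)                ≡⟨ cong (λ s → y ∨ nonemptyᵇ s) (∩-zeroˡ {n = φ} p) ⟩
  y ∨ nonemptyᵇ (⊥ {φ})               ≡⟨ cong (y ∨_) (nonemptyᵇ-⊥ φ) ⟩
  y ∨ false                            ≡⟨ Bool.∨-identityʳ y ⟩
  y                                    ∎
nonemptyᵇ-singleton-∩ (suc f) (y ∷ p) = nonemptyᵇ-singleton-∩ f p

∣∣≡∑ : ∀ {n} (p : Subset n) → ∣ p ∣ ≡ ∑[ i < n ] ⟦ lookup p i ⟧
∣∣≡∑ []            = refl
∣∣≡∑ (inside  ∷ p) = cong suc (∣∣≡∑ p)
∣∣≡∑ (outside ∷ p) = ∣∣≡∑ p

∣p∣≤0⇒p≡⊥ : ∀ {n} (p : Subset n) → ∣ p ∣ ≤ 0 → p ≡ ⊥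
∣p∣≤0⇒p≡⊥ []            _ = refl
∣p∣≤0⇒p≡⊥ (outside ∷ p) h = cong (outside ∷_) (∣p∣≤0⇒p≡⊥ p h)

∣p∣≥1⇒member : ∀ {n} (p : Subset n) → 1 ≤ ∣ p ∣ → ∃ λ f → f ∈ p
∣p∣≥1⇒member (inside  ∷ p) _ = zero , here
∣p∣≥1⇒member (outside ∷ p) h with ∣p∣≥1⇒member p h
... | f , f∈p = suc f , there f∈p

∣p∣≥2⇒two-members : ∀ {n} (p : Subset n) → 2 ≤ ∣ p ∣ → ∃₂ λ f g → ¬ f ≡ g × f ∈ p × g ∈ p
∣p∣≥2⇒two-members (inside ∷ p) (s≤s h) with ∣p∣≥1⇒member p h
... | g , g∈p = zero , suc g , (λ ()) , here , there g∈p
∣p∣≥2⇒two-members (outside ∷ p) h with ∣p∣≥2⇒two-members p h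
... | f , g , f≢g , f∈p , g∈p = suc f , suc g , f≢g ∘ Fin.suc-injective , there f∈p , there g∈p

∪-⊆ : ∀ {n} {p q r : Subset n} → p ⊆ r → q ⊆ r → p ∪ q ⊆ r
∪-⊆ {p = p} {q} p⊆r q⊆r x∈p∪q with x∈p∪q⁻ p q x∈p∪q
... | inj₁ x∈p = p⊆r x∈p
... | inj₂ x∈q = q⊆r x∈q

⊈⇒witness : ∀ {n} (p q : Subset n) → ¬ (p ⊆ q) → ∃ λ x → x ∈ p × x ∉ q
⊈⇒witness {n} p q p⊈q with Fin.¬∀⟶∃¬ n (λ x → x ∈ p → x ∈ q) (λ x → (x ∈? p) →-dec (x ∈? q)) (λ h → p⊈q (h _))
... | x , ¬[x∈p→x∈q] with x ∈? p
...   | yes x∈p = x , x∈p , λ x∈q → ¬[x∈p→x∈q] (λ _ → x∈q)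
...   | no  x∉p = ⊥-elim (¬[x∈p→x∈q] (λ x∈p → ⊥-elim (x∉p x∈p)))

-- Inclusion–exclusion

∑⊆ : ∀ φ → (Subset φ → ℤ) → ℤ
∑⊆ zero    g = g []
∑⊆ (suc φ) g = ∑⊆ φ (λ B → g (outside ∷ B)) +ℤ ∑⊆ φ (λ B → g (inside ∷ B))

infix 5 ∑⊆
syntax ∑⊆ φ (λ B → e) = ∑[ B ⊆ φ ] e

∑⊆-cong : ∀ φ {g h : Subset φ → ℤ} → (∀ B → g B ≡ h B) → ∑⊆ φ g ≡ ∑⊆ φ h
∑⊆-cong zero    e = e []
∑⊆-cong (suc φ) e = cong₂ _+ℤ_ (∑⊆-cong φ (λ B → e (outside ∷ B))) (∑⊆-cong φ (λ B → e (inside ∷ B)))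

∑⊆-0 : ∀ φ → ∑[ B ⊆ φ ] 0ℤ ≡ 0ℤ
∑⊆-0 zero    = refl
∑⊆-0 (suc φ) = cong₂ _+ℤ_ (∑⊆-0 φ) (∑⊆-0 φ)

∑⊆-neg : ∀ φ (g : Subset φ → ℤ) → ∑[ B ⊆ φ ] - g B ≡ - ∑⊆ φ g
∑⊆-neg zero    g = refl
∑⊆-neg (suc φ) g =
  trans (cong₂ _+ℤ_ (∑⊆-neg φ _) (∑⊆-neg φ _)) (sym (ℤ.neg-distrib-+ (∑⊆ φ (λ B → g (outside ∷ B))) _))

alternating : ℕ → ℤ
alternating zero          = 1ℤ
alternating (suc zero)    = -1ℤ
alternating (suc (suc j)) = alternating j

alternating-suc : ∀ j → alternating (suc j) ≡ - alternating j
alternating-suc zero          = refl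
alternating-suc (suc zero)    = refl
alternating-suc (suc (suc j)) = alternating-suc j

ieSign : ℕ → ℤ
ieSign zero    = 0ℤ
ieSign (suc j) = alternating j

∑⊆-alternating : ∀ {φ} (p : Subset φ) → ∑[ B ⊆ φ ] alternating ∣ B ∣ *ℤ + ⟦ B ⊆ᵇ p ⟧ ≡ + ⟦ not (nonemptyᵇ p) ⟧
∑⊆-alternating []            = refl
∑⊆-alternating {suc φ} (outside ∷ p) = begin
  (∑[ B ⊆ φ ] alternating ∣ B ∣ *ℤ + ⟦ B ⊆ᵇ p ⟧) +ℤ (∑[ B ⊆ φ ] alternating (suc ∣ B ∣) *ℤ 0ℤ)
    ≡⟨ cong₂ _+ℤ_ (∑⊆-alternating p) (trans (∑⊆-cong φ (λ B → ℤ.*-zeroʳ (alternating (suc ∣ B ∣)))) (∑⊆-0 φ)) ⟩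
  + ⟦ not (nonemptyᵇ p) ⟧ +ℤ 0ℤ ≡⟨ ℤ.+-identityʳ _ ⟩
  + ⟦ not (nonemptyᵇ p) ⟧ ∎
∑⊆-alternating {suc φ} (inside ∷ p) = begin
  S +ℤ (∑[ B ⊆ φ ] alternating (suc ∣ B ∣) *ℤ + ⟦ B ⊆ᵇ p ⟧) ≡⟨ cong (S +ℤ_) (trans (∑⊆-cong φ flip) (∑⊆-neg φ _)) ⟩
  S +ℤ - S                                                 ≡⟨ ℤ.+-inverseʳ S ⟩
  0ℤ                                                       ∎
  where
  S = ∑[ B ⊆ φ ] alternating ∣ B ∣ *ℤ + ⟦ B ⊆ᵇ p ⟧
  flip : ∀ B → alternating (suc ∣ B ∣) *ℤ + ⟦ B ⊆ᵇ p ⟧ ≡ - (alternating ∣ B ∣ *ℤ + ⟦ B ⊆ᵇ p ⟧)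
  flip B = trans (cong (_*ℤ + ⟦ B ⊆ᵇ p ⟧) (alternating-suc ∣ B ∣)) (sym (ℤ.neg-distribˡ-* (alternating ∣ B ∣) _))

inclusion-exclusion : ∀ {φ} (p : Subset φ) → ∑[ B ⊆ φ ] ieSign ∣ B ∣ *ℤ + ⟦ B ⊆ᵇ p ⟧ ≡ + ⟦ nonemptyᵇ p ⟧
inclusion-exclusion []            = refl
inclusion-exclusion {suc φ} (outside ∷ p) = begin
  (∑[ B ⊆ φ ] ieSign ∣ B ∣ *ℤ + ⟦ B ⊆ᵇ p ⟧) +ℤ (∑[ B ⊆ φ ] alternating ∣ B ∣ *ℤ 0ℤ)
    ≡⟨ cong₂ _+ℤ_ (inclusion-exclusion p) (trans (∑⊆-cong φ (λ B → ℤ.*-zeroʳ (alternating ∣ B ∣))) (∑⊆-0 φ)) ⟩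
  + ⟦ nonemptyᵇ p ⟧ +ℤ 0ℤ ≡⟨ ℤ.+-identityʳ _ ⟩
  + ⟦ nonemptyᵇ p ⟧ ∎
inclusion-exclusion (inside ∷ p) =
  trans (cong₂ _+ℤ_ (inclusion-exclusion p) (∑⊆-alternating p)) (⟦b⟧+⟦not-b⟧ (nonemptyᵇ p))
  where
  ⟦b⟧+⟦not-b⟧ : ∀ b → + ⟦ b ⟧ +ℤ + ⟦ not b ⟧ ≡ 1ℤ
  ⟦b⟧+⟦not-b⟧ true  = refl
  ⟦b⟧+⟦not-b⟧ false = refl

∑⊆-∑ : ∀ φ {n} (g : Subset φ → Fin n → ℤ) → ∑[ B ⊆ φ ] ℤ∑.sum (g B) ≡ ℤ∑.sum (λ i → ∑[ B ⊆ φ ] g B i)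
∑⊆-∑ zero    g = refl
∑⊆-∑ (suc φ) g = trans (cong₂ _+ℤ_ (∑⊆-∑ φ (λ B → g (outside ∷ B))) (∑⊆-∑ φ (λ B → g (inside ∷ B))))
  (sym (ℤ∑.∑-distrib-+ (λ i → ∑[ B ⊆ φ ] g (outside ∷ B) i) (λ i → ∑[ B ⊆ φ ] g (inside ∷ B) i)))

∑⊆-∑∑ : ∀ φ {m n} (g : Subset φ → Fin m → Fin n → ℤ) →
        ∑[ B ⊆ φ ] ℤ∑.sum (λ i → ℤ∑.sum (g B i)) ≡ ℤ∑.sum (λ i → ℤ∑.sum (λ j → ∑[ B ⊆ φ ] g B i j))
∑⊆-∑∑ φ g = trans (∑⊆-∑ φ (λ B i → ℤ∑.sum (g B i))) (ℤ∑.sum-cong-≗ (λ i → ∑⊆-∑ φ (λ B → g B i)))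

-- Shapes of F-sets read off vertex profiles

does-∈? : ∀ {n} (v : Fin n) (s : Subset n) → does (v ∈? s) ≡ lookup s v
does-∈? zero    (inside  ∷ s) = refl
does-∈? zero    (outside ∷ s) = refl
does-∈? (suc v) (_ ∷ s)       = does-∈? v s

lookup-profile : ∀ {φ n} (W : Fin φ → Subset n) v f → lookup (profile W v) f ≡ lookup (W f) v
lookup-profile W v f = trans (Vec.lookup∘tabulate _ f) (does-∈? v (W f))

tabulate-profile : ∀ {φ n} (W : Fin φ → Subset n) v → tabulate (λ f → lookup (W f) v) ≡ profile W v
tabulate-profile W v = Vec.tabulate-cong (λ f → sym (does-∈? v (W f)))

lookup-⋃ : ∀ {φ n} (W : Fin φ → Subset n) xs v → lookup (⋃ (map W xs)) v ≡ any (λ f → lookup (W f) v) xs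
lookup-⋃ W []       v = Vec.lookup-replicate v outside
lookup-⋃ W (f ∷ xs) v = trans (Vec.lookup-zipWith _∨_ v (W f) _) (cong (lookup (W f) v ∨_) (lookup-⋃ W xs v))

lookup-⋂ : ∀ {φ n} (W : Fin φ → Subset n) xs v → lookup (⋂ (map W xs)) v ≡ all (λ f → lookup (W f) v) xs
lookup-⋂ W []       v = Vec.lookup-replicate v inside
lookup-⋂ W (f ∷ xs) v = trans (Vec.lookup-zipWith _∧_ v (W f) _) (cong (lookup (W f) v ∧_) (lookup-⋂ W xs v))

any-filter-tabulate : ∀ {φ ψ} (A : Subset ψ) (h : Fin φ → Fin ψ) (g : Fin ψ → Bool) →
  any g (filter (_∈? A) (List.tabulate h)) ≡ nonemptyᵇ (tabulate (lookup A ∘ h) ∩ tabulate (g ∘ h))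
any-filter-tabulate {zero}  A h g = refl
any-filter-tabulate {suc φ} A h g rewrite does-∈? (h zero) A with lookup A (h zero)
... | true  = cong (g (h zero) ∨_) (any-filter-tabulate A (h ∘ suc) g)
... | false = any-filter-tabulate A (h ∘ suc) g

all-filter-tabulate : ∀ {φ ψ} (A : Subset ψ) (h : Fin φ → Fin ψ) (g : Fin ψ → Bool) →
  all g (filter (_∈? A) (List.tabulate h)) ≡ tabulate (lookup A ∘ h) ⊆ᵇ tabulate (g ∘ h)
all-filter-tabulate {zero}  A h g = refl
all-filter-tabulate {suc φ} A h g rewrite does-∈? (h zero) A with lookup A (h zero)
... | true  = cong (g (h zero) ∧_) (all-filter-tabulate A (h ∘ suc) g)
... | false = all-filter-tabulate A (h ∘ suc) g

nonemptyᵇ≡any-filter : ∀ {φ} (A : Subset φ) → nonemptyᵇ A ≡ any (λ _ → true) (filter (_∈? A) (allFin φ))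
nonemptyᵇ≡any-filter A = sym (begin
  any (λ _ → true) (filter (_∈? A) (allFin _)) ≡⟨ any-filter-tabulate A id (λ _ → true) ⟩
  nonemptyᵇ (tabulate (lookup A) ∩ tabulate (λ _ → true))
    ≡⟨ cong₂ (λ a t → nonemptyᵇ (a ∩ t)) (Vec.tabulate∘lookup A) (tabulate-const true) ⟩
  nonemptyᵇ (A ∩ ⊤) ≡⟨ cong nonemptyᵇ (∩-identityʳ A) ⟩
  nonemptyᵇ A ∎)

W₀≡W∪⊤ : ∀ {φ n} (W : Fin φ → Subset n) → W₀ W ≡ W∪ W ⊤
W₀≡W∪⊤ {φ} W = cong (⋃ ∘ map W) (sym (List.filter-all (_∈? ⊤) (universal (λ _ → ∈⊤) (allFin φ))))

lookup-W∪ : ∀ {φ n} (W : Fin φ → Subset n) A v → lookup (W∪ W A) v ≡ nonemptyᵇ (A ∩ profile W v)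
lookup-W∪ {φ} W A v = begin
  lookup (W∪ W A) v                                            ≡⟨ lookup-⋃ W (filter (_∈? A) (allFin φ)) v ⟩
  any (λ f → lookup (W f) v) (filter (_∈? A) (allFin φ))       ≡⟨ any-filter-tabulate A id _ ⟩
  nonemptyᵇ (tabulate (lookup A) ∩ tabulate (λ f → lookup (W f) v))
    ≡⟨ cong₂ (λ a q → nonemptyᵇ (a ∩ q)) (Vec.tabulate∘lookup A) (tabulate-profile W v) ⟩
  nonemptyᵇ (A ∩ profile W v)                                  ∎

lookup-W₀ : ∀ {φ n} (W : Fin φ → Subset n) v → lookup (W₀ W) v ≡ nonemptyᵇ (profile W v)
lookup-W₀ W v = begin
  lookup (W₀ W) v                ≡⟨ cong (λ s → lookup s v) (W₀≡W∪⊤ W) ⟩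
  lookup (W∪ W ⊤) v              ≡⟨ lookup-W∪ W ⊤ v ⟩
  nonemptyᵇ (⊤ ∩ profile W v)    ≡⟨ cong nonemptyᵇ (∩-identityˡ (profile W v)) ⟩
  nonemptyᵇ (profile W v)        ∎

lookup-W∩ : ∀ {φ n} (W : Fin φ → Subset n) A v → lookup (W∩ W A) v ≡ capᵇ A (profile W v)
lookup-W∩ {φ} W A v with filter (_∈? A) (allFin φ) in eq
... | [] rewrite trans (nonemptyᵇ≡any-filter A) (cong (any _) eq) = lookup-W₀ W v
... | f ∷ fs rewrite trans (nonemptyᵇ≡any-filter A) (cong (any _) eq) = begin
  lookup (⋂ (map W (f ∷ fs))) v                           ≡⟨ lookup-⋂ W (f ∷ fs) v ⟩
  all (λ g → lookup (W g) v) (f ∷ fs)                     ≡⟨ cong (all _) eq ⟨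
  all (λ g → lookup (W g) v) (filter (_∈? A) (allFin φ))  ≡⟨ all-filter-tabulate A id _ ⟩
  tabulate (lookup A) ⊆ᵇ tabulate (λ g → lookup (W g) v)
    ≡⟨ cong₂ _⊆ᵇ_ (Vec.tabulate∘lookup A) (tabulate-profile W v) ⟩
  A ⊆ᵇ profile W v                                        ∎

lookup-W! : ∀ {φ n} (W : Fin φ → Subset n) A v → lookup (W! W A) v ≡ exclᵇ A (profile W v)
lookup-W! W A v = trans (Vec.lookup∘tabulate _ v)
  (cong (_∧ does (Vec.≡-dec Bool._≟_ (profile W v) A)) (trans (does-∈? v (W₀ W)) (lookup-W₀ W v)))

∣∣≡∑-by-profile : ∀ {φ n} (W : Fin φ → Subset n) (s : Subset n) (G : Subset φ → Bool) →
                  (∀ v → lookup s v ≡ G (profile W v)) → ∣ s ∣ ≡ ∑[ v < n ] ⟦ G (profile W v) ⟧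
∣∣≡∑-by-profile W s G e = trans (∣∣≡∑ s) (sum-cong-≗ (cong ⟦_⟧ ∘ e))

zer-shape : ∀ {φ n} (W : Fin φ → Subset n) → zer (shape W) ≡ ∑[ v < n ] ⟦ nonemptyᵇ (profile W v) ⟧
zer-shape W = ∣∣≡∑-by-profile W (W₀ W) nonemptyᵇ (lookup-W₀ W)

cap-shape : ∀ {φ n} (W : Fin φ → Subset n) A → cap (shape W) A ≡ ∑[ v < n ] ⟦ capᵇ A (profile W v) ⟧
cap-shape W A = ∣∣≡∑-by-profile W (W∩ W A) (capᵇ A) (lookup-W∩ W A)

cup-shape : ∀ {φ n} (W : Fin φ → Subset n) A → cup (shape W) A ≡ ∑[ v < n ] ⟦ nonemptyᵇ (A ∩ profile W v) ⟧
cup-shape W A = ∣∣≡∑-by-profile W (W∪ W A) (λ p → nonemptyᵇ (A ∩ p)) (lookup-W∪ W A)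

excl-shape : ∀ {φ n} (W : Fin φ → Subset n) A → excl (shape W) A ≡ ∑[ v < n ] ⟦ exclᵇ A (profile W v) ⟧
excl-shape W A = ∣∣≡∑-by-profile W (W! W A) (exclᵇ A) (lookup-W! W A)

∑-lookup-profile : ∀ {φ n} (W : Fin φ → Subset n) f → ∑[ v < n ] ⟦ lookup (profile W v) f ⟧ ≡ ∣ W f ∣
∑-lookup-profile W f = trans (sum-cong-≗ (λ v → cong ⟦_⟧ (lookup-profile W v f))) (sym (∣∣≡∑ (W f)))

cap-singleton : ∀ {φ n} (W : Fin φ → Subset n) f → cap (shape W) (singleton f) ≡ ∣ W f ∣
cap-singleton W f = trans (cap-shape W (singleton f))
  (trans (sum-cong-≗ (λ v → cong ⟦_⟧ (capᵇ-singleton f (profile W v)))) (∑-lookup-profile W f))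

cup-singleton : ∀ {φ n} (W : Fin φ → Subset n) f → cup (shape W) (singleton f) ≡ ∣ W f ∣
cup-singleton W f = trans (cup-shape W (singleton f))
  (trans (sum-cong-≗ (λ v → cong ⟦_⟧ (nonemptyᵇ-singleton-∩ f (profile W v)))) (∑-lookup-profile W f))

cup-⊥ : ∀ {φ n} (W : Fin φ → Subset n) → cup (shape W) ⊥ ≡ 0
cup-⊥ {φ} {n} W = trans (cup-shape W ⊥)
  (trans (sum-cong-≗ (λ v → cong ⟦_⟧ (trans (cong nonemptyᵇ (∩-zeroˡ (profile W v))) (nonemptyᵇ-⊥ φ))))
         (sum-replicate-zero n))

∑-∣profile∣ : ∀ {φ n} (W : Fin φ → Subset n) → ∑[ v < n ] ∣ profile W v ∣ ≡ ∑[ f < φ ] ∣ W f ∣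
∑-∣profile∣ W = trans (sum-cong-≗ (λ v → ∣∣≡∑ (profile W v)))
  (trans (∑-comm (λ v f → ⟦ lookup (profile W v) f ⟧)) (sum-cong-≗ (∑-lookup-profile W)))

∈-profile : ∀ {φ n} (W : Fin φ → Subset n) {f v} → v ∈ W f → f ∈ profile W v
∈-profile W {f} {v} v∈Wf = Vec.lookup⇒[]= f _ (trans (lookup-profile W v f) (Vec.[]=⇒lookup v∈Wf))

⊆-W∪ : ∀ {φ n} (W : Fin φ → Subset n) {f A} → f ∈ A → W f ⊆ W∪ W A
⊆-W∪ W {f} {A} f∈A {v} v∈Wf = Vec.lookup⇒[]= v _
  (trans (lookup-W∪ W A v) (∈⇒nonemptyᵇ (x∈p∩q⁺ (f∈A , ∈-profile W v∈Wf))))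

≈S-sym : ∀ {φ} {v w : ShapeData φ} → v ≈S w → w ≈S v
≈S-sym (cap≡ , excl≡ , cup≡ , zer≡) = sym ∘ cap≡ , sym ∘ excl≡ , sym ∘ cup≡ , sym zer≡

≈S-trans : ∀ {φ} {u v w : ShapeData φ} → u ≈S v → v ≈S w → u ≈S w
≈S-trans (cap₁ , excl₁ , cup₁ , zer₁) (cap₂ , excl₂ , cup₂ , zer₂) =
  (λ A → trans (cap₁ A) (cap₂ A)) , (λ A → trans (excl₁ A) (excl₂ A)) ,
  (λ A → trans (cup₁ A) (cup₂ A)) , trans zer₁ zer₂

pure-sizes : ∀ {φ n m} (W : Fin φ → Subset n) {w : ShapeData φ} → shape W ≈S w → IsPure m w → ∀ f → ∣ W f ∣ ≡ m
pure-sizes W (cap≡ , _) pure f = trans (sym (cap-singleton W f)) (trans (cap≡ (singleton f)) (pure f))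

-- prod₀ and term compute with functions local to their where blocks; the
-- metavariables below are solved by unification to those functions, which can
-- then be reasoned about by induction.
mutual
  private
    prod₀-sum : ∀ {φ} → ShapeData φ → ShapeData φ → List ℤ → ℤ
    prod₀-sum x w = _

  prod₀-unfold : ∀ {φ} (x w : ShapeData φ) → prod₀ x w ≡ prod₀-sum x w (map (term x w) (allSubsets φ))
  prod₀-unfold {φ} x w with map (term x w) (allSubsets φ)
  ... | l = refl

private
  prod₀-sum-foldr : ∀ {φ} (x w : ShapeData φ) l → prod₀-sum x w l ≡ foldr _+ℤ_ 0ℤ l
  prod₀-sum-foldr x w [] = refl
  prod₀-sum-foldr x w (z ∷ l) = cong (z +ℤ_) (prod₀-sum-foldr x w l)

mutual
  private
    TermSignLaw : ∀ {φ} → ShapeData φ → ShapeData φ → Subset φ → ℕ → ℕ → Set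
    TermSignLaw x w B a i = _

  term-≡ : ∀ {φ} (x w : ShapeData φ) B → term x w B ≡ ieSign ∣ B ∣ *ℤ + (cap x B * cap w B)
  term-≡ x w B with ∣ B ∣
  ... | zero = refl
  ... | suc zero = refl
  ... | suc (suc zero) = refl
  ... | suc (suc (suc i)) with suc (suc i)
  ...   | a = termSignLaw x w B a i

  private
    termSignLaw : ∀ {φ} (x w : ShapeData φ) B a i → TermSignLaw x w B a i
    termSignLaw x w B a zero = refl
    termSignLaw x w B a (suc zero) = refl
    termSignLaw x w B a (suc (suc i)) = termSignLaw x w B a i

foldr-+-++ : ∀ (xs ys : List ℤ) → foldr _+ℤ_ 0ℤ (xs ++ ys) ≡ foldr _+ℤ_ 0ℤ xs +ℤ foldr _+ℤ_ 0ℤ ys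
foldr-+-++ []       ys = sym (ℤ.+-identityˡ _)
foldr-+-++ (x ∷ xs) ys = trans (cong (x +ℤ_) (foldr-+-++ xs ys)) (sym (ℤ.+-assoc x _ _))

foldr-+-allSubsets : ∀ φ (g : Subset φ → ℤ) → foldr _+ℤ_ 0ℤ (map g (allSubsets φ)) ≡ ∑⊆ φ g
foldr-+-allSubsets zero    g = ℤ.+-identityʳ (g [])
foldr-+-allSubsets (suc φ) g = begin
  Σ (map g (map (outside ∷_) S ++ map (inside ∷_) S))
    ≡⟨ cong Σ (List.map-++ g (map (outside ∷_) S) _) ⟩
  Σ (map g (map (outside ∷_) S) ++ map g (map (inside ∷_) S))
    ≡⟨ foldr-+-++ (map g (map (outside ∷_) S)) _ ⟩
  Σ (map g (map (outside ∷_) S)) +ℤ Σ (map g (map (inside ∷_) S))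
    ≡⟨ cong₂ _+ℤ_ (cong Σ (sym (List.map-∘ S))) (cong Σ (sym (List.map-∘ S))) ⟩
  Σ (map (λ B → g (outside ∷ B)) S) +ℤ Σ (map (λ B → g (inside ∷ B)) S)
    ≡⟨ cong₂ _+ℤ_ (foldr-+-allSubsets φ _) (foldr-+-allSubsets φ _) ⟩
  ∑⊆ (suc φ) g ∎
  where
  S = allSubsets φ
  Σ = foldr _+ℤ_ 0ℤ

prod₀-≡-∑⊆ : ∀ {φ} (x w : ShapeData φ) → prod₀ x w ≡ ∑[ B ⊆ φ ] ieSign ∣ B ∣ *ℤ + (cap x B * cap w B)
prod₀-≡-∑⊆ {φ} x w = begin
  prod₀ x w                                      ≡⟨ prod₀-unfold x w ⟩
  prod₀-sum x w (map (term x w) (allSubsets φ)) ≡⟨ prod₀-sum-foldr x w (map (term x w) (allSubsets φ)) ⟩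
  foldr _+ℤ_ 0ℤ (map (term x w) (allSubsets φ))  ≡⟨ foldr-+-allSubsets φ (term x w) ⟩
  ∑⊆ φ (term x w)                                ≡⟨ ∑⊆-cong φ (term-≡ x w) ⟩
  ∑[ B ⊆ φ ] ieSign ∣ B ∣ *ℤ + (cap x B * cap w B) ∎

prod₀-cong-cap : ∀ {φ} (x : ShapeData φ) {w w′} → (∀ B → cap w B ≡ cap w′ B) → prod₀ x w ≡ prod₀ x w′
prod₀-cong-cap {φ} x {w} {w′} cap≡ = begin
  prod₀ x w
    ≡⟨ prod₀-≡-∑⊆ x w ⟩
  ∑[ B ⊆ φ ] ieSign ∣ B ∣ *ℤ + (cap x B * cap w B)
    ≡⟨ ∑⊆-cong φ (λ B → cong (λ c → ieSign ∣ B ∣ *ℤ + (cap x B * c)) (cap≡ B)) ⟩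
  ∑[ B ⊆ φ ] ieSign ∣ B ∣ *ℤ + (cap x B * cap w′ B)
    ≡⟨ prod₀-≡-∑⊆ x w′ ⟨
  prod₀ x w′ ∎

cap-product : ∀ {φ n₁ n₂} (X : Fin φ → Subset n₁) (W : Fin φ → Subset n₂) B → nonemptyᵇ B ≡ true →
  cap (shape X) B * cap (shape W) B ≡ ∑[ u < n₁ ] ∑[ v < n₂ ] ⟦ B ⊆ᵇ (profile X u ∩ profile W v) ⟧
cap-product {n₁ = n₁} {n₂} X W B B≠∅ = begin
  cap (shape X) B * cap (shape W) B
    ≡⟨ cong₂ _*_ (cap-shape X B) (cap-shape W B) ⟩
  (∑[ u < n₁ ] ⟦ capᵇ B (profile X u) ⟧) * (∑[ v < n₂ ] ⟦ capᵇ B (profile W v) ⟧)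
    ≡⟨ cong₂ _*_ (sum-cong-≗ (cong ⟦_⟧ ∘ capᵇ≡⊆ᵇ ∘ profile X)) (sum-cong-≗ (cong ⟦_⟧ ∘ capᵇ≡⊆ᵇ ∘ profile W)) ⟩
  (∑[ u < n₁ ] ⟦ B ⊆ᵇ profile X u ⟧) * (∑[ v < n₂ ] ⟦ B ⊆ᵇ profile W v ⟧)
    ≡⟨ *-distribʳ-sum _ (λ u → ⟦ B ⊆ᵇ profile X u ⟧) ⟩
  ∑[ u < n₁ ] (⟦ B ⊆ᵇ profile X u ⟧ * ∑[ v < n₂ ] ⟦ B ⊆ᵇ profile W v ⟧)
    ≡⟨ sum-cong-≗ (λ u → *-distribˡ-sum ⟦ B ⊆ᵇ profile X u ⟧ (λ v → ⟦ B ⊆ᵇ profile W v ⟧)) ⟩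
  ∑[ u < n₁ ] ∑[ v < n₂ ] (⟦ B ⊆ᵇ profile X u ⟧ * ⟦ B ⊆ᵇ profile W v ⟧)
    ≡⟨ sum-cong-≗ (λ u → sum-cong-≗ (λ v → trans (⟦∧⟧ (B ⊆ᵇ profile X u) (B ⊆ᵇ profile W v))
                                                (cong ⟦_⟧ (⊆ᵇ-∩ B (profile X u) (profile W v))))) ⟩
  ∑[ u < n₁ ] ∑[ v < n₂ ] ⟦ B ⊆ᵇ (profile X u ∩ profile W v) ⟧ ∎
  where
  capᵇ≡⊆ᵇ : ∀ p → capᵇ B p ≡ B ⊆ᵇ p
  capᵇ≡⊆ᵇ p rewrite B≠∅ = refl

ieSign-cap-product : ∀ {φ n₁ n₂} (X : Fin φ → Subset n₁) (W : Fin φ → Subset n₂) B →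
  ieSign ∣ B ∣ *ℤ + (cap (shape X) B * cap (shape W) B) ≡
  ieSign ∣ B ∣ *ℤ + (∑[ u < n₁ ] ∑[ v < n₂ ] ⟦ B ⊆ᵇ (profile X u ∩ profile W v) ⟧)
ieSign-cap-product X W B with nonemptyᵇ B in B≠∅
... | true  = cong (λ c → ieSign ∣ B ∣ *ℤ + c) (cap-product X W B B≠∅)
... | false rewrite ¬nonemptyᵇ⇒∣p∣≡0 B B≠∅ = refl

prod₀-shape : ∀ {φ n₁ n₂} (X : Fin φ → Subset n₁) (W : Fin φ → Subset n₂) →
  prod₀ (shape X) (shape W) ≡ + (∑[ v < n₂ ] cup (shape X) (profile W v))
prod₀-shape {φ} {n₁} {n₂} X W = begin
  prod₀ (shape X) (shape W)
    ≡⟨ prod₀-≡-∑⊆ (shape X) (shape W) ⟩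
  ∑[ B ⊆ φ ] ieSign ∣ B ∣ *ℤ + (cap (shape X) B * cap (shape W) B)
    ≡⟨ ∑⊆-cong φ (λ B → trans (ieSign-cap-product X W B) (*-+-∑∑ (ieSign ∣ B ∣) (T B))) ⟩
  ∑[ B ⊆ φ ] ℤ∑.sum (λ u → ℤ∑.sum (λ v → ieSign ∣ B ∣ *ℤ + T B u v))
    ≡⟨ ∑⊆-∑∑ φ (λ B u v → ieSign ∣ B ∣ *ℤ + T B u v) ⟩
  ℤ∑.sum (λ u → ℤ∑.sum (λ v → ∑[ B ⊆ φ ] ieSign ∣ B ∣ *ℤ + T B u v))
    ≡⟨ ℤ∑.sum-cong-≗ (λ u → ℤ∑.sum-cong-≗ (λ v → inclusion-exclusion (profile X u ∩ profile W v))) ⟩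
  ℤ∑.sum (λ u → ℤ∑.sum (λ v → + N u v))
    ≡⟨ +-∑∑ N ⟨
  + (∑[ u < n₁ ] ∑[ v < n₂ ] N u v)
    ≡⟨ cong +_ (∑-comm N) ⟩
  + (∑[ v < n₂ ] ∑[ u < n₁ ] N u v)
    ≡⟨ cong +_ (sum-cong-≗ (λ v → trans (sum-cong-≗ (λ u → N-comm u v)) (sym (cup-shape X (profile W v))))) ⟩
  + (∑[ v < n₂ ] cup (shape X) (profile W v)) ∎
  where
  T : Subset φ → Fin n₁ → Fin n₂ → ℕ
  T B u v = ⟦ B ⊆ᵇ (profile X u ∩ profile W v) ⟧
  N : Fin n₁ → Fin n₂ → ℕ
  N u v = ⟦ nonemptyᵇ (profile X u ∩ profile W v) ⟧
  N-comm : ∀ u v → N u v ≡ ⟦ nonemptyᵇ (profile W v ∩ profile X u) ⟧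
  N-comm u v = cong (⟦_⟧ ∘ nonemptyᵇ) (∩-comm (profile X u) (profile W v))

-- Pairwise disjoint F-sets

PairwiseDisjoint : ∀ {φ n} → (Fin φ → Subset n) → Set
PairwiseDisjoint {n = n} W = ∀ (v : Fin n) → ∣ profile W v ∣ ≤ 1

∑-lookup-⊥ : ∀ {φ} (h : Fin φ → ℕ) → ∑[ f < φ ] (⟦ lookup (⊥ {φ}) f ⟧ * h f) ≡ 0
∑-lookup-⊥ {φ} h =
  trans (sum-cong-≗ (λ f → cong (λ b → ⟦ b ⟧ * h f) (Vec.lookup-replicate f outside))) (sum-replicate-zero φ)

decompose-by-singletons : ∀ {φ} (H : Subset φ → ℕ) → H ⊥ ≡ 0 → (p : Subset φ) → ∣ p ∣ ≤ 1 →
                          H p ≡ ∑[ f < φ ] (⟦ lookup p f ⟧ * H (singleton f))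
decompose-by-singletons H H⊥ []            _ = H⊥
decompose-by-singletons H H⊥ (outside ∷ p) h = decompose-by-singletons (λ q → H (outside ∷ q)) H⊥ p h
decompose-by-singletons {suc φ} H H⊥ (inside ∷ p) (s≤s h) rewrite ∣p∣≤0⇒p≡⊥ p h = begin
  H (inside ∷ ⊥)
    ≡⟨ cong H singleton-zero ⟨
  H (singleton zero)
    ≡⟨ ℕ.+-identityʳ _ ⟨
  H (singleton zero) + 0
    ≡⟨ cong₂ _+_ (ℕ.*-identityˡ _) (∑-lookup-⊥ (H ∘ singleton ∘ suc)) ⟨
  1 * H (singleton zero) + ∑[ f < φ ] (⟦ lookup (⊥ {φ}) f ⟧ * H (singleton (suc f))) ∎

∑-profile-disjoint : ∀ {φ n} (W : Fin φ → Subset n) → PairwiseDisjoint W → (H : Subset φ → ℕ) → H ⊥ ≡ 0 →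
                     ∑[ v < n ] H (profile W v) ≡ ∑[ f < φ ] (∣ W f ∣ * H (singleton f))
∑-profile-disjoint {φ} {n} W disjoint H H⊥ = begin
  ∑[ v < n ] H (profile W v)
    ≡⟨ sum-cong-≗ (λ v → decompose-by-singletons H H⊥ (profile W v) (disjoint v)) ⟩
  ∑[ v < n ] ∑[ f < φ ] (⟦ lookup (profile W v) f ⟧ * H (singleton f))
    ≡⟨ ∑-comm (λ v f → ⟦ lookup (profile W v) f ⟧ * H (singleton f)) ⟩
  ∑[ f < φ ] ∑[ v < n ] (⟦ lookup (profile W v) f ⟧ * H (singleton f))
    ≡⟨ sum-cong-≗ (λ f → *-distribʳ-sum (H (singleton f)) (λ v → ⟦ lookup (profile W v) f ⟧)) ⟨
  ∑[ f < φ ] (∑[ v < n ] ⟦ lookup (profile W v) f ⟧ * H (singleton f))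
    ≡⟨ sum-cong-≗ (λ f → cong (_* H (singleton f)) (∑-lookup-profile W f)) ⟩
  ∑[ f < φ ] (∣ W f ∣ * H (singleton f)) ∎

∑-profile-disjoint-≡ : ∀ {φ n₁ n₂} (W : Fin φ → Subset n₁) (R : Fin φ → Subset n₂) →
  PairwiseDisjoint W → PairwiseDisjoint R → (∀ f → ∣ W f ∣ ≡ ∣ R f ∣) →
  (G : Subset φ → Bool) → G ⊥ ≡ false →
  ∑[ v < n₁ ] ⟦ G (profile W v) ⟧ ≡ ∑[ v < n₂ ] ⟦ G (profile R v) ⟧
∑-profile-disjoint-≡ W R W-disj R-disj ∣W∣≡∣R∣ G G⊥ = begin
  ∑[ v < _ ] ⟦ G (profile W v) ⟧               ≡⟨ ∑-profile-disjoint W W-disj (⟦_⟧ ∘ G) (cong ⟦_⟧ G⊥) ⟩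
  ∑[ f < _ ] (∣ W f ∣ * ⟦ G (singleton f) ⟧)   ≡⟨ sum-cong-≗ (λ f → cong (_* ⟦ G (singleton f) ⟧) (∣W∣≡∣R∣ f)) ⟩
  ∑[ f < _ ] (∣ R f ∣ * ⟦ G (singleton f) ⟧)   ≡⟨ ∑-profile-disjoint R R-disj (⟦_⟧ ∘ G) (cong ⟦_⟧ G⊥) ⟨
  ∑[ v < _ ] ⟦ G (profile R v) ⟧               ∎

shape-disjoint-≈S : ∀ {φ n₁ n₂} (W : Fin φ → Subset n₁) (R : Fin φ → Subset n₂) →
  PairwiseDisjoint W → PairwiseDisjoint R → (∀ f → ∣ W f ∣ ≡ ∣ R f ∣) → shape W ≈S shape R
shape-disjoint-≈S {φ} W R W-disj R-disj ∣W∣≡∣R∣ =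
  (λ A → via (capᵇ A) (cap-shape W A) (cap-shape R A) (capᵇ-⊥ A)) ,
  (λ A → via (exclᵇ A) (excl-shape W A) (excl-shape R A)
             (cong (_∧ does (Vec.≡-dec Bool._≟_ ⊥ A)) (nonemptyᵇ-⊥ φ))) ,
  (λ A → via (λ p → nonemptyᵇ (A ∩ p)) (cup-shape W A) (cup-shape R A)
             (trans (cong nonemptyᵇ (∩-zeroʳ A)) (nonemptyᵇ-⊥ φ))) ,
  via nonemptyᵇ (zer-shape W) (zer-shape R) (nonemptyᵇ-⊥ φ)
  where
  via : ∀ {a b} G → a ≡ ∑[ v < _ ] ⟦ G (profile W v) ⟧ → b ≡ ∑[ v < _ ] ⟦ G (profile R v) ⟧ →
        G ⊥ ≡ false → a ≡ b
  via G a≡ b≡ G⊥ = trans a≡ (trans (∑-profile-disjoint-≡ W R W-disj R-disj ∣W∣≡∣R∣ G G⊥) (sym b≡))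

disjoint-or-overlap : ∀ {φ n} (W : Fin φ → Subset n) → PairwiseDisjoint W ⊎ ∃ λ v → 2 ≤ ∣ profile W v ∣
disjoint-or-overlap {n = n} W with Fin.all? (λ v → ∣ profile W v ∣ ℕ.≤? 1)
... | yes disjoint = inj₁ disjoint
... | no ¬disjoint with Fin.¬∀⟶∃¬ n _ (λ v → ∣ profile W v ∣ ℕ.≤? 1) ¬disjoint
...   | v , ∣q∣≰1 = inj₂ (v , ℕ.≰⇒> ∣q∣≰1)

no-overlap⇒disjoint : ∀ {φ n} (R : Fin φ → Subset n) {r : ShapeData φ} → shape R ≈S r →
                      (∀ A → ∣ A ∣ ≥ 2 → cap r A ≡ 0) → PairwiseDisjoint R
no-overlap⇒disjoint R (cap≡ , _) no-overlap v with ∣ profile R v ∣ ℕ.≤? 1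
... | yes ∣q∣≤1 = ∣q∣≤1
... | no  ∣q∣≰1 = ⊥-elim (ℕ.<⇒≢ counted (sym (trans (cap≡ q) (no-overlap q 2≤∣q∣))))
  where
  q = profile R v
  2≤∣q∣ = ℕ.≰⇒> ∣q∣≰1
  self-counted : capᵇ q q ≡ true
  self-counted rewrite ∈⇒nonemptyᵇ (proj₂ (∣p∣≥1⇒member q (ℕ.<⇒≤ 2≤∣q∣))) = ⊆ᵇ-refl q
  counted : 1 ≤ cap (shape R) q
  counted = subst (1 ≤_) (sym (cap-shape R q))
    (ℕ.≤-trans (ℕ.≤-reflexive (cong ⟦_⟧ (sym self-counted))) (≤-∑ (λ u → ⟦ capᵇ q (profile R u) ⟧) v))

zer-disjoint : ∀ {φ n m} (R : Fin φ → Subset n) → PairwiseDisjoint R → (∀ f → ∣ R f ∣ ≡ m) → zer (shape R) ≡ φ * m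
zer-disjoint {φ} {m = m} R disjoint ∣R∣≡m = begin
  zer (shape R)
    ≡⟨ zer-shape R ⟩
  ∑[ v < _ ] ⟦ nonemptyᵇ (profile R v) ⟧
    ≡⟨ ∑-profile-disjoint R disjoint (⟦_⟧ ∘ nonemptyᵇ) (cong ⟦_⟧ (nonemptyᵇ-⊥ φ)) ⟩
  ∑[ f < φ ] (∣ R f ∣ * ⟦ nonemptyᵇ (singleton f) ⟧)
    ≡⟨ sum-cong-≗ (λ f → cong₂ (λ s t → s * ⟦ t ⟧) (∣R∣≡m f) (nonemptyᵇ-singleton f)) ⟩
  ∑[ f < φ ] (m * 1)
    ≡⟨ trans (∑-const φ (m * 1)) (cong (φ *_) (ℕ.*-identityʳ m)) ⟩
  φ * m ∎

prod₀-disjoint : ∀ {φ n₁ n₂ k m} (X : Fin φ → Subset n₁) → IsPureComplex k X →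
  (R : Fin φ → Subset n₂) → PairwiseDisjoint R → (∀ f → ∣ R f ∣ ≡ m) → prod₀ (shape X) (shape R) ≡ + (φ * m * k)
prod₀-disjoint {φ} {k = k} {m} X pure R disjoint ∣R∣≡m = trans (prod₀-shape X R) (cong +_ (begin
  ∑[ v < _ ] cup (shape X) (profile R v)
    ≡⟨ ∑-profile-disjoint R disjoint (cup (shape X)) (cup-⊥ X) ⟩
  ∑[ f < φ ] (∣ R f ∣ * cup (shape X) (singleton f))
    ≡⟨ sum-cong-≗ (λ f → cong₂ _*_ (∣R∣≡m f) (trans (cup-singleton X f) (pure f))) ⟩
  ∑[ f < φ ] (m * k)
    ≡⟨ trans (∑-const φ (m * k)) (sym (ℕ.*-assoc φ m k)) ⟩
  φ * m * k ∎))

-- The vertex bound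

k<∣facet∪facet∣ : ∀ {φ n k} (X : Fin φ → Subset n) → IsFacetFamily X → IsPureComplex k X →
                   ∀ {f g} → ¬ f ≡ g → suc k ≤ ∣ X f ∪ X g ∣
k<∣facet∪facet∣ {k = k} X facets pure {f} {g} f≢g
  with ⊈⇒witness (X f) (X g) (f≢g ∘ IsFacetFamily.antichain facets f g)
... | u , u∈Xf , u∉Xg = subst (λ c → suc c ≤ ∣ X f ∪ X g ∣) (pure g)
  (p⊂q⇒∣p∣<∣q∣ (q⊆p∪q (X f) (X g) , u , x∈p∪q⁺ (inj₁ u∈Xf) , u∉Xg))

module _ {φ n k} (X : Fin φ → Subset n) (facets : IsFacetFamily X) (pure : IsPureComplex k X)
         {x₀ m M} (kx₀φ<m : k * x₀ * φ < m) (m≤M : m ≤ M) where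

  vertex-bound-strict : ∀ q → 2 ≤ ∣ q ∣ → k * x₀ * ∣ q ∣ + k * M * ⟦ nonemptyᵇ q ⟧ < cup (shape X) q * (x₀ + M)
  vertex-bound-strict q 2≤∣q∣ with ∣p∣≥2⇒two-members q 2≤∣q∣
  ... | f , g , f≢g , f∈q , g∈q rewrite ∈⇒nonemptyᵇ f∈q =
    vertex-inequality-many k x₀ φ m M ∣ q ∣ (cup (shape X) q) kx₀φ<m m≤M (∣p∣≤n q)
      (ℕ.≤-trans (k<∣facet∪facet∣ X facets pure f≢g) (p⊆q⇒∣p∣≤∣q∣ (∪-⊆ (⊆-W∪ X f∈q) (⊆-W∪ X g∈q))))

  vertex-bound : ∀ q → k * x₀ * ∣ q ∣ + k * M * ⟦ nonemptyᵇ q ⟧ ≤ cup (shape X) q * (x₀ + M)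
  vertex-bound q with ∣ q ∣ in ∣q∣≡
  ... | zero rewrite ∣p∣≤0⇒p≡⊥ q (ℕ.≤-reflexive ∣q∣≡) | nonemptyᵇ-⊥ φ
                   | ℕ.*-zeroʳ (k * x₀) | ℕ.*-zeroʳ (k * M) = z≤n
  ... | suc zero with ∣p∣≥1⇒member q (ℕ.≤-reflexive (sym ∣q∣≡))
  ...   | f , f∈q rewrite ∈⇒nonemptyᵇ f∈q =
    vertex-inequality-one k x₀ M (cup (shape X) q) (subst (_≤ cup (shape X) q) (pure f) (p⊆q⇒∣p∣≤∣q∣ (⊆-W∪ X f∈q)))
  vertex-bound q | suc (suc c) = ℕ.<⇒≤
    (subst (λ c′ → k * x₀ * c′ + k * M * ⟦ nonemptyᵇ q ⟧ < cup (shape X) q * (x₀ + M)) ∣q∣≡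
           (vertex-bound-strict q (subst (2 ≤_) (sym ∣q∣≡) (s≤s (s≤s z≤n)))))

∑-vertex-bound : ∀ {φ n n′ k} (X : Fin φ → Subset n) → IsFacetFamily X → IsPureComplex k X →
  ∀ {x₀ m} → k * x₀ * φ < m → (W : Fin φ → Subset n′) → (∀ f → ∣ W f ∣ ≡ m) → ∀ v₀ → 2 ≤ ∣ profile W v₀ ∣ →
  φ * m * k * (x₀ + zer (shape W)) < (∑[ v < n′ ] cup (shape X) (profile W v)) * (x₀ + φ * m)
∑-vertex-bound {φ} {n′ = n′} {k} X facets pure {x₀} {m} kx₀φ<m W ∣W∣≡m v₀ 2≤∣q₀∣ =
  subst₂ _<_ ∑-lhs (sym (*-distribʳ-sum (x₀ + φ * m) U))
    (∑-mono-< (vertex-bound X facets pure kx₀φ<m m≤M ∘ profile W) v₀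
              (vertex-bound-strict X facets pure kx₀φ<m m≤M (profile W v₀) 2≤∣q₀∣))
  where
  c : Fin n′ → ℕ
  c v = ∣ profile W v ∣
  a : Fin n′ → ℕ
  a v = ⟦ nonemptyᵇ (profile W v) ⟧
  U : Fin n′ → ℕ
  U v = cup (shape X) (profile W v)
  m≤M : m ≤ φ * m
  m≤M = ℕ.m≤n*m m φ {{>-nonZero (ℕ.≤-trans (s≤s z≤n) (ℕ.≤-trans 2≤∣q₀∣ (∣p∣≤n (profile W v₀))))}}
  ∑-lhs : ∑[ v < n′ ] (k * x₀ * c v + k * (φ * m) * a v) ≡ φ * m * k * (x₀ + zer (shape W))
  ∑-lhs = begin
    ∑[ v < n′ ] (k * x₀ * c v + k * (φ * m) * a v)
      ≡⟨ ∑-distrib-+ (λ v → k * x₀ * c v) (λ v → k * (φ * m) * a v) ⟩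
    ∑[ v < n′ ] (k * x₀ * c v) + ∑[ v < n′ ] (k * (φ * m) * a v)
      ≡⟨ cong₂ _+_ (*-distribˡ-sum (k * x₀) c) (*-distribˡ-sum (k * (φ * m)) a) ⟨
    k * x₀ * (∑[ v < n′ ] c v) + k * (φ * m) * (∑[ v < n′ ] a v)
      ≡⟨ cong₂ (λ s t → k * x₀ * s + k * (φ * m) * t)
               (trans (∑-∣profile∣ W) (trans (sum-cong-≗ ∣W∣≡m) (∑-const φ m))) (sym (zer-shape W)) ⟩
    k * x₀ * (φ * m) + k * (φ * m) * zer (shape W)
      ≡⟨ vertex-sum-identity k x₀ φ m (zer (shape W)) ⟩
    φ * m * k * (x₀ + zer (shape W)) ∎

zer-positive : ∀ {φ n} (W : Fin φ → Subset n) v → 1 ≤ ∣ profile W v ∣ → 1 ≤ zer (shape W)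
zer-positive W v 1≤∣q∣ = subst (1 ≤_) (sym (zer-shape W))
  (ℕ.≤-trans (ℕ.≤-reflexive (cong ⟦_⟧ (sym (∈⇒nonemptyᵇ (proj₂ (∣p∣≥1⇒member (profile W v) 1≤∣q∣))))))
             (≤-∑ (λ u → ⟦ nonemptyᵇ (profile W u) ⟧) v))

/-cross-< : ∀ a c d₁ d₂ → a * suc d₂ < c * suc d₁ → + a / suc d₁ <ℚ + c / suc d₂
/-cross-< a c d₁ d₂ lt = ℚ.toℚᵘ-cancel-<
  (ℚᵘ.<-respʳ-≃ (ℚᵘ.≃-sym (ℚ.toℚᵘ-fromℚᵘ q)) (ℚᵘ.<-respˡ-≃ (ℚᵘ.≃-sym (ℚ.toℚᵘ-fromℚᵘ p))
    (ℚᵘ.*<* (subst₂ _<ℤ_ (ℤ.pos-* a (suc d₂)) (ℤ.pos-* c (suc d₁)) (+<+ lt)))))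
  where
  p = ℚᵘ.mkℚᵘ (+ a) d₁
  q = ℚᵘ.mkℚᵘ (+ c) d₂

b-< : ∀ {φ} (x r w : ShapeData φ) {a c} → 0 < zer x + zer w → prod₀ x r ≡ + a → prod₀ x w ≡ + c →
      a * (zer x + zer w) < c * (zer x + zer r) → b x r <ℚ b x w
b-< x r w {a} {c} 0<w prod-r prod-w lt with zer x + zer r | zer x + zer w
... | zero   | w₀     = ⊥-elim (ℕ.n≮0 (subst (a * w₀ <_) (ℕ.*-zeroʳ c) lt))
... | suc d₁ | suc d₂ =
  subst₂ _<ℚ_ (cong (_/ suc d₁) (sym prod-r)) (cong (_/ suc d₂) (sym prod-w)) (/-cross-< a c d₁ d₂ lt)

b-cong-≈S : ∀ {φ} (x : ShapeData φ) {w w′} → w ≈S w′ → b x w ≡ b x w′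
b-cong-≈S x {w} {w′} (cap≡ , _ , _ , zer≡) with zer x + zer w | zer x + zer w′ | cong (_+_ (zer x)) zer≡
... | zero  | _ | refl = refl
... | suc d | _ | refl = cong (_/ suc d) (prod₀-cong-cap x cap≡)

b-disjoint<b-overlapping : ∀ {φ n n₁ n₂ k m} (X : Fin φ → Subset n) → IsFacetFamily X → IsPureComplex k X →
  k * zer (shape X) * φ < m →
  (R : Fin φ → Subset n₁) → PairwiseDisjoint R → (∀ f → ∣ R f ∣ ≡ m) →
  (W : Fin φ → Subset n₂) → (∀ f → ∣ W f ∣ ≡ m) → ∀ v₀ → 2 ≤ ∣ profile W v₀ ∣ →
  b (shape X) (shape R) <ℚ b (shape X) (shape W)
b-disjoint<b-overlapping {φ} {n₂ = n₂} {k} {m} X facets pure kx₀φ<m R R-disjoint ∣R∣≡m W ∣W∣≡m v₀ 2≤∣q₀∣ =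
  b-< (shape X) (shape R) (shape W)
    (ℕ.≤-trans (zer-positive W v₀ (ℕ.<⇒≤ 2≤∣q₀∣)) (ℕ.m≤n+m _ _))
    (prod₀-disjoint X pure R R-disjoint ∣R∣≡m) (prod₀-shape X W)
    (subst (λ z → φ * m * k * (x₀ + zer (shape W)) < P * (x₀ + z)) (sym (zer-disjoint R R-disjoint ∣R∣≡m))
      (∑-vertex-bound X facets pure kx₀φ<m W ∣W∣≡m v₀ 2≤∣q₀∣))
  where
  x₀ = zer (shape X)
  P = ∑[ v < n₂ ] cup (shape X) (profile W v)

lemma3 : (k m φ n : ℕ) → 1 ≤ k → (X : Fin φ → Subset n) → IsFacetFamily X → IsPureComplex k X →
    k * zer (shape X) * φ < m →
    (r : ShapeData φ) → IsFShape r → IsPure m r → (∀ (A : Subset φ) → ∣ A ∣ ≥ 2 → cap r A ≡ 0) →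
    (w : ShapeData φ) → IsFShape w → IsPure m w → ¬ (w ≈S r) →
    b (shape X) r <ℚ b (shape X) w
lemma3 k m φ n _ X facets pure kx₀φ<m r (_ , R , R≈r) r-pure no-overlap w (_ , W , W≈w) w-pure w≉r
  with disjoint-or-overlap W
... | inj₁ W-disjoint = ⊥-elim (w≉r (≈S-trans (≈S-sym W≈w) (≈S-trans W≈R R≈r)))
  where
  W≈R = shape-disjoint-≈S W R W-disjoint (no-overlap⇒disjoint R R≈r no-overlap)
          (λ f → trans (pure-sizes W W≈w w-pure f) (sym (pure-sizes R R≈r r-pure f)))
... | inj₂ (v₀ , 2≤∣q₀∣) = subst₂ _<ℚ_ (b-cong-≈S (shape X) R≈r) (b-cong-≈S (shape X) W≈w)
  (b-disjoint<b-overlapping X facets pure kx₀φ<m R (no-overlap⇒disjoint R R≈r no-overlap) (pure-sizes R R≈r r-pure)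
                            W (pure-sizes W W≈w w-pure) v₀ 2≤∣q₀∣)
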